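{- For all $n\ge1$, in the multiset $f^n(01^{n+1})=f^{n-1}(0A^n)$, the multiplicities satisfy $$m(01)-m(10)=m(00)-m(11)=1\cdot2\cdot4\cdots2^{n-1}=2^{n(n-1)/2}.$$
   Context: $A=\{0,1\}$, $\varphi(0)=01$, $\varphi(1)=10$. A $\varphi$-factorization of a word $u$ is a factorization $u=w_0\varphi(a_1)w_1\cdots\varphi(a_k)w_k$ with $k\ge1$, $a_i\in A$, $w_i\in A^*$, identified with its tuple of positions $(|w_0|,|w_0\varphi(a_1)w_1|,\ldots)$; to each such factorization $\kappa$ associate the language $\mathcal{L}(u,\kappa)=A^{|w_0|}a_1A^{|w_1|}\cdots a_kA^{|w_k|}$ (multiplicities $1$). $f(u)$ is the multiset sum of $\mathcal{L}(u,\kappa)$ over all $\varphi$-factorizations of $u$ ($f(u)=\emptyset$ if $u\in0^*\cup1^*$). For a finite multiset $M$, $f(M)$ is the multiset sum of $f(v)$ over $v\in M$ counted with multiplicity; $f^0(u)=\{u\}$ and $f^{i+1}=f\circ f^i$. $0A^n$ is the set of words of length $n+1$ starting with $0$, viewed as a multiset with multiplicities $1$. $m(x)$ denotes the multiplicity of $x$ in the multiset under consideration. -}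

module Defs where

open import Data.Nat using (ℕ; zero; suc)
open import Data.List using (List; []; _∷_; _++_; map; concatMap)
open import Data.Bool using (Bool; true; false; if_then_else_)
open import Relation.Nullary using (yes; no)
open import Relation.Binary.PropositionalEquality using (_≡_)
open import Relation.Binary.Definitions using (DecidableEquality)
import Data.List.Properties as LP

data Bit : Set where
  𝟎 𝟏 : Bit

_≟ᵇ_ : DecidableEquality Bit
𝟎 ≟ᵇ 𝟎 = yes Relation.Binary.PropositionalEquality.refl
𝟎 ≟ᵇ 𝟏 = no (λ ())
𝟏 ≟ᵇ 𝟎 = no (λ ())
𝟏 ≟ᵇ 𝟏 = yes Relation.Binary.PropositionalEquality.refl

Word : Set
Word = List Bit

_≟w_ : DecidableEquality Word
_≟w_ = LP.≡-dec _≟ᵇ_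

-- Finite multisets are lists (order irrelevant; multiplicity = number of occurrences).
Multiset : Set
Multiset = List Word

φ : Bit → Word
φ 𝟎 = 𝟎 ∷ 𝟏 ∷ []
φ 𝟏 = 𝟏 ∷ 𝟎 ∷ []

-- A factorization u = w₀ φ(a₁) w₁ ⋯ φ(a_k) w_k is recorded as the sequence of
-- its blocks read left to right: each letter of some wᵢ is a 'letter' block,
-- each φ(aᵢ) is an 'img aᵢ' block.  (k ≥ 0 here; k ≥ 1 is imposed below.)
data Block : Set where
  letter : Block
  img    : Bit → Block

-- All block sequences decomposing u as (letters of wᵢ) and factors φ(a):
-- these are exactly the factorizations of u (without the k ≥ 1 condition).
factorizations : Word → List (List Block)
factorizations [] = [] ∷ []
factorizations (x ∷ []) = (letter ∷ []) ∷ []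
factorizations (x ∷ y ∷ ys) =
  map (letter ∷_) (factorizations (y ∷ ys))
  ++ imgCase x y (factorizations ys)
  where
  -- x y is a factor φ(a) iff (x , y) = (a , ā), in which case a = x
  imgCase : Bit → Bit → List (List Block) → List (List Block)
  imgCase 𝟎 𝟏 fs = map (img 𝟎 ∷_) fs
  imgCase 𝟏 𝟎 fs = map (img 𝟏 ∷_) fs
  imgCase _ _ fs = []

-- k ≥ 1 : at least one φ-block
isφFact : List Block → Bool
isφFact [] = false
isφFact (letter ∷ bs) = isφFact bs
isφFact (img _ ∷ bs) = true

allWords : ℕ → Multiset
allWords zero = [] ∷ []
allWords (suc n) = map (𝟎 ∷_) (allWords n) ++ map (𝟏 ∷_) (allWords n)

-- the language L(u,κ) = A^{|w₀|} a₁ A^{|w₁|} ⋯ a_k A^{|w_k|}, multiplicities 1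
lang : List Block → Multiset
lang [] = [] ∷ []
lang (letter ∷ bs) = map (𝟎 ∷_) (lang bs) ++ map (𝟏 ∷_) (lang bs)
lang (img a ∷ bs) = map (a ∷_) (lang bs)

f : Word → Multiset
f u = concatMap (λ κ → if isφFact κ then lang κ else []) (factorizations u)

fM : Multiset → Multiset
fM M = concatMap f M

fIter : ℕ → Multiset → Multiset
fIter zero M = M
fIter (suc i) M = fM (fIter i M)

fPow : ℕ → Word → Multiset
fPow i u = fIter i (u ∷ [])

m : Word → Multiset → ℕ
m x [] = 0
m x (y ∷ M) with x ≟w y
... | yes _ = suc (m x M)
... | no _ = m x M

zeroA : ℕ → Multiset
zeroA n = map (𝟎 ∷_) (allWords n)

-- Since f shortens words, only the words of M of length ≥ L + 2 contribute to the
-- multiplicity of a word d·x of length L + 1 in f(M).  Counting factorizations, d·x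
-- occurs τ(L) + [c = d]·2^L times in f(c·A^(L+1)), with τ(L) independent of c and d.
-- So if the words of length L + 2 of M are those of b·A^(L+2) + D·0A^(L+1), the
-- words of length L + 1 of f(M) are those of b'·A^(L+1) + D·2^L·0A^L.  Starting
-- from f(01^(n+1)) = 0A^n (b = 0, D = 1) and applying f another n - 1 times gives
-- the difference D = 2^((n-1) + ⋯ + 1) on words of length 2.
module Submission where

open import Defs
open import Data.Bool using (true; false; if_then_else_)
open import Data.Empty using (⊥-elim)
open import Data.List using (List; []; _∷_; _++_; map; concatMap; length; replicate)
open import Data.List.Properties using (map-++; map-∘; concatMap-++; ++-identityʳ)
open import Data.List.Relation.Binary.Permutation.Propositional using (_↭_; ↭-refl)
open import Data.List.Relation.Unary.All as All using (All; []; _∷_)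
open import Data.Nat
open import Data.Nat.DivMod using (m*n/n≡m)
open import Data.Nat.ListAction using (sum)
open import Data.Nat.ListAction.Properties using (sum-++)
open import Data.Nat.Properties
open import Data.Nat.Tactic.RingSolver using (solve-∀)
open import Data.Product using (∃; _×_; _,_; proj₂)
open import Data.Sum using (_⊎_; inj₁; inj₂)
open import Function using (_∘_)
open import Relation.Nullary using (yes; no)
open import Relation.Binary.PropositionalEquality
open ≡-Reasoning

δ : Bit → Bit → ℕ
δ 𝟎 𝟎 = 1
δ 𝟎 𝟏 = 0
δ 𝟏 𝟎 = 0
δ 𝟏 𝟏 = 1

m-∷ : ∀ x y M → m x (y ∷ M) ≡ m x (y ∷ []) + m x M
m-∷ x y M with x ≟w y
... | yes _ = refl
... | no _ = refl

m-self : ∀ y M → m y (y ∷ M) ≡ suc (m y M)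
m-self y M with y ≟w y
... | yes _ = refl
... | no y≢y = ⊥-elim (y≢y refl)

m-++ : ∀ x A B → m x (A ++ B) ≡ m x A + m x B
m-++ x [] B = refl
m-++ x (y ∷ A) B with x ≟w y
... | yes _ = cong suc (m-++ x A B)
... | no _ = m-++ x A B

m-concatMap : ∀ {A : Set} (g : A → Multiset) x xs → m x (concatMap g xs) ≡ sum (map (λ y → m x (g y)) xs)
m-concatMap g x [] = refl
m-concatMap g x (y ∷ xs) = trans (m-++ x (g y) (concatMap g xs)) (cong (m x (g y) +_) (m-concatMap g x xs))

m-∷-singleton : ∀ c d x y → m (c ∷ x) ((d ∷ y) ∷ []) ≡ δ c d * m x (y ∷ [])
m-∷-singleton 𝟎 𝟏 x y = refl
m-∷-singleton 𝟏 𝟎 x y = refl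
m-∷-singleton 𝟎 𝟎 x y with x ≟w y
... | yes _ = refl
... | no _ = refl
m-∷-singleton 𝟏 𝟏 x y with x ≟w y
... | yes _ = refl
... | no _ = refl

m-∷-map : ∀ c d x L → m (c ∷ x) (map (d ∷_) L) ≡ δ c d * m x L
m-∷-map c d x [] = sym (*-zeroʳ (δ c d))
m-∷-map c d x (y ∷ L) = begin
  m (c ∷ x) ((d ∷ y) ∷ map (d ∷_) L)                ≡⟨ m-∷ (c ∷ x) (d ∷ y) _ ⟩
  m (c ∷ x) ((d ∷ y) ∷ []) + m (c ∷ x) (map (d ∷_) L) ≡⟨ cong₂ _+_ (m-∷-singleton c d x y) (m-∷-map c d x L) ⟩
  δ c d * m x (y ∷ []) + δ c d * m x L               ≡⟨ *-distribˡ-+ (δ c d) _ _ ⟨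
  δ c d * (m x (y ∷ []) + m x L)                     ≡⟨ cong (δ c d *_) (m-∷ x y L) ⟨
  δ c d * m x (y ∷ L)                                ∎

m-[]-map : ∀ d L → m [] (map (d ∷_) L) ≡ 0
m-[]-map d [] = refl
m-[]-map d (y ∷ L) = m-[]-map d L

m-∷-bothPrefixes : ∀ c x L → m (c ∷ x) (map (𝟎 ∷_) L ++ map (𝟏 ∷_) L) ≡ m x L
m-∷-bothPrefixes c x L = begin
  m (c ∷ x) (map (𝟎 ∷_) L ++ map (𝟏 ∷_) L)            ≡⟨ m-++ (c ∷ x) (map (𝟎 ∷_) L) _ ⟩
  m (c ∷ x) (map (𝟎 ∷_) L) + m (c ∷ x) (map (𝟏 ∷_) L) ≡⟨ cong₂ _+_ (m-∷-map c 𝟎 x L) (m-∷-map c 𝟏 x L) ⟩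
  δ c 𝟎 * m x L + δ c 𝟏 * m x L                        ≡⟨ δ-partition c (m x L) ⟩
  m x L                                                ∎
  where
  δ-partition : ∀ c n → δ c 𝟎 * n + δ c 𝟏 * n ≡ n
  δ-partition 𝟎 n = trans (+-identityʳ (n + 0)) (+-identityʳ n)
  δ-partition 𝟏 n = +-identityʳ n

m-allWords-length : ∀ K y → length y ≡ K → m y (allWords K) ≡ 1
m-allWords-length zero [] _ = refl
m-allWords-length (suc K) (c ∷ y) |y|≡1+K =
  trans (m-∷-bothPrefixes c y (allWords K)) (m-allWords-length K y (suc-injective |y|≡1+K))

m-allWords-≢ : ∀ K y → length y ≢ K → m y (allWords K) ≡ 0
m-allWords-≢ zero [] |y|≢0 = ⊥-elim (|y|≢0 refl)
m-allWords-≢ zero (c ∷ y) _ = refl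
m-allWords-≢ (suc K) [] _ = trans (m-++ [] (map (𝟎 ∷_) (allWords K)) _)
                                  (cong₂ _+_ (m-[]-map 𝟎 (allWords K)) (m-[]-map 𝟏 (allWords K)))
m-allWords-≢ (suc K) (c ∷ y) |y|≢1+K =
  trans (m-∷-bothPrefixes c y (allWords K)) (m-allWords-≢ K y (|y|≢1+K ∘ cong suc))

-- Unlike f, this also counts the trivial factorization (k = 0), whose language is A^|u|.
langCount : Word → Word → ℕ
langCount u x = m x (concatMap lang (factorizations u))

imageBranch : Bit → Bit → List (List Block) → List (List Block)
imageBranch 𝟎 𝟏 F = map (img 𝟎 ∷_) F
imageBranch 𝟏 𝟎 F = map (img 𝟏 ∷_) F
imageBranch 𝟎 𝟎 F = []
imageBranch 𝟏 𝟏 F = []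

factorizations-∷∷ : ∀ p q u →
  factorizations (p ∷ q ∷ u) ≡ map (letter ∷_) (factorizations (q ∷ u)) ++ imageBranch p q (factorizations u)
factorizations-∷∷ 𝟎 𝟎 u = refl
factorizations-∷∷ 𝟎 𝟏 u = refl
factorizations-∷∷ 𝟏 𝟎 u = refl
factorizations-∷∷ 𝟏 𝟏 u = refl

imgWeight : Bit → Bit → Bit → ℕ
imgWeight 𝟎 𝟏 c = δ c 𝟎
imgWeight 𝟏 𝟎 c = δ c 𝟏
imgWeight 𝟎 𝟎 c = 0
imgWeight 𝟏 𝟏 c = 0

module FactorizationCount
    (h : List Block → Multiset)
    (m-h-letter : ∀ κ c x → m (c ∷ x) (h (letter ∷ κ)) ≡ m x (h κ))
    (m-h-img : ∀ a κ x → m x (h (img a ∷ κ)) ≡ m x (lang (img a ∷ κ)))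
  where

  count : Word → Word → ℕ
  count u x = m x (concatMap h (factorizations u))

  m-concatMap-++ : ∀ x A B → m x (concatMap h (A ++ B)) ≡ m x (concatMap h A) + m x (concatMap h B)
  m-concatMap-++ x A B = trans (cong (m x) (concatMap-++ h A B)) (m-++ x (concatMap h A) _)

  m-concatMap-letters : ∀ F c x → m (c ∷ x) (concatMap h (map (letter ∷_) F)) ≡ m x (concatMap h F)
  m-concatMap-letters [] c x = refl
  m-concatMap-letters (κ ∷ F) c x =
    trans (m-++ (c ∷ x) (h (letter ∷ κ)) _)
      (trans (cong₂ _+_ (m-h-letter κ c x) (m-concatMap-letters F c x)) (sym (m-++ x (h κ) _)))

  m-concatMap-imgs : ∀ a F c x → m (c ∷ x) (concatMap h (map (img a ∷_) F)) ≡ δ c a * m x (concatMap lang F)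
  m-concatMap-imgs a [] c x = sym (*-zeroʳ (δ c a))
  m-concatMap-imgs a (κ ∷ F) c x = begin
    m (c ∷ x) (h (img a ∷ κ) ++ concatMap h (map (img a ∷_) F))
      ≡⟨ m-++ (c ∷ x) (h (img a ∷ κ)) _ ⟩
    m (c ∷ x) (h (img a ∷ κ)) + m (c ∷ x) (concatMap h (map (img a ∷_) F))
      ≡⟨ cong₂ _+_ (trans (m-h-img a κ (c ∷ x)) (m-∷-map c a x (lang κ))) (m-concatMap-imgs a F c x) ⟩
    δ c a * m x (lang κ) + δ c a * m x (concatMap lang F)
      ≡⟨ *-distribˡ-+ (δ c a) _ _ ⟨
    δ c a * (m x (lang κ) + m x (concatMap lang F))
      ≡⟨ cong (δ c a *_) (m-++ x (lang κ) _) ⟨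
    δ c a * m x (concatMap lang (κ ∷ F))
      ∎

  m-concatMap-imageBranch : ∀ p q F c x →
    m (c ∷ x) (concatMap h (imageBranch p q F)) ≡ imgWeight p q c * m x (concatMap lang F)
  m-concatMap-imageBranch 𝟎 𝟏 F c x = m-concatMap-imgs 𝟎 F c x
  m-concatMap-imageBranch 𝟏 𝟎 F c x = m-concatMap-imgs 𝟏 F c x
  m-concatMap-imageBranch 𝟎 𝟎 F c x = refl
  m-concatMap-imageBranch 𝟏 𝟏 F c x = refl

  count-∷∷ : ∀ p q u c x → count (p ∷ q ∷ u) (c ∷ x) ≡ count (q ∷ u) x + imgWeight p q c * langCount u x
  count-∷∷ p q u c x = begin
    count (p ∷ q ∷ u) (c ∷ x)
      ≡⟨ cong (m (c ∷ x) ∘ concatMap h) (factorizations-∷∷ p q u) ⟩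
    m (c ∷ x) (concatMap h (map (letter ∷_) (factorizations (q ∷ u)) ++ imageBranch p q (factorizations u)))
      ≡⟨ m-concatMap-++ (c ∷ x) (map (letter ∷_) (factorizations (q ∷ u))) _ ⟩
    m (c ∷ x) (concatMap h (map (letter ∷_) (factorizations (q ∷ u))))
      + m (c ∷ x) (concatMap h (imageBranch p q (factorizations u)))
      ≡⟨ cong₂ _+_ (m-concatMap-letters (factorizations (q ∷ u)) c x)
                   (m-concatMap-imageBranch p q (factorizations u) c x) ⟩
    count (q ∷ u) x + imgWeight p q c * langCount u x
      ∎

φLang : List Block → Multiset
φLang κ = if isφFact κ then lang κ else []

m-φLang-letter : ∀ κ c x → m (c ∷ x) (φLang (letter ∷ κ)) ≡ m x (φLang κ)
m-φLang-letter κ c x with isφFact κ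
... | true = m-∷-bothPrefixes c x (lang κ)
... | false = refl

open FactorizationCount lang (λ κ c x → m-∷-bothPrefixes c x (lang κ)) (λ _ _ _ → refl)
  using () renaming (count-∷∷ to langCount-∷∷)
open FactorizationCount φLang m-φLang-letter (λ _ _ _ → refl)
  using () renaming (count-∷∷ to m-f-∷∷)

langCount-short : ∀ u x → length u < length x → langCount u x ≡ 0
langCount-short [] (c ∷ x) _ = refl
langCount-short (p ∷ []) (c ∷ []) (s≤s ())
langCount-short (p ∷ []) (c ∷ d ∷ x) _ =
  trans (m-++ (c ∷ d ∷ x) (lang (letter ∷ [])) []) (cong (_+ 0) (m-∷-bothPrefixes c (d ∷ x) ([] ∷ [])))
langCount-short (p ∷ q ∷ u) (c ∷ x) (s≤s |qu|<|x|) = begin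
  langCount (p ∷ q ∷ u) (c ∷ x)                    ≡⟨ langCount-∷∷ p q u c x ⟩
  langCount (q ∷ u) x + imgWeight p q c * langCount u x
    ≡⟨ cong₂ (λ s t → s + imgWeight p q c * t) (langCount-short (q ∷ u) x |qu|<|x|)
                                                (langCount-short u x (<-trans (n<1+n _) |qu|<|x|)) ⟩
  imgWeight p q c * 0                              ≡⟨ *-zeroʳ (imgWeight p q c) ⟩
  0                                                ∎

langCount-same : ∀ u x → length x ≡ length u → langCount u x ≡ 1
langCount-same [] [] _ = refl
langCount-same (p ∷ []) (𝟎 ∷ []) _ = refl
langCount-same (p ∷ []) (𝟏 ∷ []) _ = refl
langCount-same (p ∷ q ∷ u) (c ∷ x) |cx|≡|pqu| = begin
  langCount (p ∷ q ∷ u) (c ∷ x)                    ≡⟨ langCount-∷∷ p q u c x ⟩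
  langCount (q ∷ u) x + imgWeight p q c * langCount u x
    ≡⟨ cong₂ (λ s t → s + imgWeight p q c * t) (langCount-same (q ∷ u) x |x|≡|qu|)
                                                (langCount-short u x (≤-reflexive (sym |x|≡|qu|))) ⟩
  1 + imgWeight p q c * 0                          ≡⟨ cong suc (*-zeroʳ (imgWeight p q c)) ⟩
  1                                                ∎
  where |x|≡|qu| = suc-injective |cx|≡|pqu|

m-f-short : ∀ u x → length u ≤ length x → m x (f u) ≡ 0
m-f-short [] x _ = refl
m-f-short (p ∷ []) x _ = refl
m-f-short (p ∷ q ∷ u) (c ∷ x) (s≤s |qu|≤|x|) = begin
  m (c ∷ x) (f (p ∷ q ∷ u))                        ≡⟨ m-f-∷∷ p q u c x ⟩
  m x (f (q ∷ u)) + imgWeight p q c * langCount u x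
    ≡⟨ cong₂ (λ s t → s + imgWeight p q c * t) (m-f-short (q ∷ u) x |qu|≤|x|) (langCount-short u x |qu|≤|x|) ⟩
  imgWeight p q c * 0                              ≡⟨ *-zeroʳ (imgWeight p q c) ⟩
  0                                                ∎

m-f-∷∷-same : ∀ p q u c x → length u ≡ length x → m (c ∷ x) (f (p ∷ q ∷ u)) ≡ m x (f (q ∷ u)) + imgWeight p q c
m-f-∷∷-same p q u c x |u|≡|x| = begin
  m (c ∷ x) (f (p ∷ q ∷ u))                          ≡⟨ m-f-∷∷ p q u c x ⟩
  m x (f (q ∷ u)) + imgWeight p q c * langCount u x  ≡⟨ cong (λ t → m x (f (q ∷ u)) + imgWeight p q c * t)
                                                            (langCount-same u x (sym |u|≡|x|)) ⟩
  m x (f (q ∷ u)) + imgWeight p q c * 1              ≡⟨ cong (m x (f (q ∷ u)) +_) (*-identityʳ (imgWeight p q c)) ⟩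
  m x (f (q ∷ u)) + imgWeight p q c                  ∎

sum-map-+ : ∀ {A : Set} (g h : A → ℕ) xs → sum (map (λ z → g z + h z) xs) ≡ sum (map g xs) + sum (map h xs)
sum-map-+ g h [] = refl
sum-map-+ g h (x ∷ xs) =
  trans (cong (g x + h x +_) (sum-map-+ g h xs)) (+-exchange (g x) (h x) (sum (map g xs)) (sum (map h xs)))
  where
  +-exchange : ∀ a b c d → a + b + (c + d) ≡ a + c + (b + d)
  +-exchange = solve-∀

sum-map-* : ∀ {A : Set} k (g : A → ℕ) xs → sum (map (λ z → k * g z) xs) ≡ k * sum (map g xs)
sum-map-* k g [] = sym (*-zeroʳ k)
sum-map-* k g (x ∷ xs) = trans (cong (k * g x +_) (sum-map-* k g xs)) (sym (*-distribˡ-+ k (g x) _))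

sum-map-zero : ∀ {A : Set} (g : A → ℕ) {xs} → All (λ x → g x ≡ 0) xs → sum (map g xs) ≡ 0
sum-map-zero g [] = refl
sum-map-zero g (gx≡0 ∷ gxs≡0) = cong₂ _+_ gx≡0 (sum-map-zero g gxs≡0)

sumWords : ℕ → (Word → ℕ) → ℕ
sumWords K g = sum (map g (allWords K))

sumWords-suc : ∀ K g → sumWords (suc K) g ≡ sumWords K (λ z → g (𝟎 ∷ z)) + sumWords K (λ z → g (𝟏 ∷ z))
sumWords-suc K g = begin
  sum (map g (map (𝟎 ∷_) W ++ map (𝟏 ∷_) W))            ≡⟨ cong sum (map-++ g (map (𝟎 ∷_) W) _) ⟩
  sum (map g (map (𝟎 ∷_) W) ++ map g (map (𝟏 ∷_) W))    ≡⟨ sum-++ (map g (map (𝟎 ∷_) W)) _ ⟩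
  sum (map g (map (𝟎 ∷_) W)) + sum (map g (map (𝟏 ∷_) W)) ≡⟨ cong₂ _+_ (cong sum (map-∘ W)) (cong sum (map-∘ W)) ⟨
  sumWords K (λ z → g (𝟎 ∷ z)) + sumWords K (λ z → g (𝟏 ∷ z)) ∎
  where W = allWords K

sumWords-cong : ∀ K g h → (∀ z → length z ≡ K → g z ≡ h z) → sumWords K g ≡ sumWords K h
sumWords-cong zero g h g≗h = cong (_+ 0) (g≗h [] refl)
sumWords-cong (suc K) g h g≗h = begin
  sumWords (suc K) g                                            ≡⟨ sumWords-suc K g ⟩
  sumWords K (λ z → g (𝟎 ∷ z)) + sumWords K (λ z → g (𝟏 ∷ z))
    ≡⟨ cong₂ _+_ (sumWords-cong K _ _ (λ z |z|≡K → g≗h (𝟎 ∷ z) (cong suc |z|≡K)))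
                 (sumWords-cong K _ _ (λ z |z|≡K → g≗h (𝟏 ∷ z) (cong suc |z|≡K))) ⟩
  sumWords K (λ z → h (𝟎 ∷ z)) + sumWords K (λ z → h (𝟏 ∷ z)) ≡⟨ sumWords-suc K h ⟨
  sumWords (suc K) h                                            ∎

sumWords-const : ∀ K k → sumWords K (λ _ → k) ≡ k * 2 ^ K
sumWords-const zero k = trans (+-identityʳ k) (sym (*-identityʳ k))
sumWords-const (suc K) k =
  trans (sumWords-suc K (λ _ → k))
        (trans (cong₂ _+_ (sumWords-const K k) (sumWords-const K k)) (double k (2 ^ K)))
  where
  double : ∀ k p → k * p + k * p ≡ k * (2 * p)
  double = solve-∀

m-as-sum : ∀ y L → sum (map (λ z → m y (z ∷ [])) L) ≡ m y L
m-as-sum y [] = refl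
m-as-sum y (z ∷ L) = trans (cong (m y (z ∷ []) +_) (m-as-sum y L)) (sym (m-∷ y z L))

m-singleton-* : ∀ z y (g : Word → ℕ) → m z (y ∷ []) * g z ≡ g y * m y (z ∷ [])
m-singleton-* z y g with z ≟w y | y ≟w z
... | yes refl | yes _ = trans (+-identityʳ (g z)) (sym (*-identityʳ (g z)))
... | yes refl | no z≢z = ⊥-elim (z≢z refl)
... | no z≢y | yes refl = ⊥-elim (z≢y refl)
... | no _ | no _ = sym (*-zeroʳ (g y))

sumWords-indicator : ∀ K y (g : Word → ℕ) → length y ≡ K ⊎ g y ≡ 0 → sumWords K (λ z → m z (y ∷ []) * g z) ≡ g y
sumWords-indicator K y g |y|≡K⊎gy≡0 = begin
  sumWords K (λ z → m z (y ∷ []) * g z) ≡⟨ sumWords-cong K _ _ (λ z _ → m-singleton-* z y g) ⟩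
  sumWords K (λ z → g y * m y (z ∷ [])) ≡⟨ sum-map-* (g y) (λ z → m y (z ∷ [])) (allWords K) ⟩
  g y * sumWords K (λ z → m y (z ∷ [])) ≡⟨ cong (g y *_) (m-as-sum y (allWords K)) ⟩
  g y * m y (allWords K)                 ≡⟨ selects |y|≡K⊎gy≡0 ⟩
  g y                                    ∎
  where
  selects : length y ≡ K ⊎ g y ≡ 0 → g y * m y (allWords K) ≡ g y
  selects (inj₁ |y|≡K) = trans (cong (g y *_) (m-allWords-length K y |y|≡K)) (*-identityʳ (g y))
  selects (inj₂ gy≡0) = trans (cong (_* m y (allWords K)) gy≡0) (sym gy≡0)

sum-byMultiplicity : ∀ K (g : Word → ℕ) M → All (λ y → length y ≡ K ⊎ g y ≡ 0) M →
  sum (map g M) ≡ sumWords K (λ z → m z M * g z)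
sum-byMultiplicity K g [] [] = sym (sumWords-const K 0)
sum-byMultiplicity K g (y ∷ M) (py ∷ pM) = sym (begin
  sumWords K (λ z → m z (y ∷ M) * g z)
    ≡⟨ sumWords-cong K _ _ (λ z _ → trans (cong (_* g z) (m-∷ z y M)) (*-distribʳ-+ (g z) (m z (y ∷ [])) (m z M))) ⟩
  sumWords K (λ z → m z (y ∷ []) * g z + m z M * g z)
    ≡⟨ sum-map-+ (λ z → m z (y ∷ []) * g z) (λ z → m z M * g z) (allWords K) ⟩
  sumWords K (λ z → m z (y ∷ []) * g z) + sumWords K (λ z → m z M * g z)
    ≡⟨ cong₂ _+_ (sumWords-indicator K y g py) (sym (sum-byMultiplicity K g M pM)) ⟩
  g y + sum (map g M)
    ∎)

column : Bit → Word → ℕ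
column c x = sumWords (length x) (λ z → m x (f (c ∷ z)))

column-∷ : ∀ c d x → column c (d ∷ x) ≡ column 𝟎 x + column 𝟏 x + δ c d * 2 ^ length x
column-∷ c d x = begin
  column c (d ∷ x)
    ≡⟨ sumWords-suc L (λ z → m (d ∷ x) (f (c ∷ z))) ⟩
  sumWords L (λ z → m (d ∷ x) (f (c ∷ 𝟎 ∷ z))) + sumWords L (λ z → m (d ∷ x) (f (c ∷ 𝟏 ∷ z)))
    ≡⟨ cong₂ _+_ (secondLetter 𝟎) (secondLetter 𝟏) ⟩
  (column 𝟎 x + imgWeight c 𝟎 d * p) + (column 𝟏 x + imgWeight c 𝟏 d * p)
    ≡⟨ regroup (column 𝟎 x) (column 𝟏 x) (imgWeight c 𝟎 d) (imgWeight c 𝟏 d) p ⟩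
  column 𝟎 x + column 𝟏 x + (imgWeight c 𝟎 d + imgWeight c 𝟏 d) * p
    ≡⟨ cong (λ w → column 𝟎 x + column 𝟏 x + w * p) (imgWeight-sum c d) ⟩
  column 𝟎 x + column 𝟏 x + δ c d * p
    ∎
  where
  L = length x
  p = 2 ^ L

  secondLetter : ∀ q → sumWords L (λ z → m (d ∷ x) (f (c ∷ q ∷ z))) ≡ column q x + imgWeight c q d * p
  secondLetter q = begin
    sumWords L (λ z → m (d ∷ x) (f (c ∷ q ∷ z)))     ≡⟨ sumWords-cong L _ _ (λ z |z|≡L → m-f-∷∷-same c q z d x |z|≡L) ⟩
    sumWords L (λ z → m x (f (q ∷ z)) + imgWeight c q d)
      ≡⟨ sum-map-+ (λ z → m x (f (q ∷ z))) (λ _ → imgWeight c q d) (allWords L) ⟩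
    column q x + sumWords L (λ _ → imgWeight c q d) ≡⟨ cong (column q x +_) (sumWords-const L (imgWeight c q d)) ⟩
    column q x + imgWeight c q d * p                 ∎

  regroup : ∀ a b i j p → (a + i * p) + (b + j * p) ≡ a + b + (i + j) * p
  regroup = solve-∀

  imgWeight-sum : ∀ c d → imgWeight c 𝟎 d + imgWeight c 𝟏 d ≡ δ c d
  imgWeight-sum 𝟎 𝟎 = refl
  imgWeight-sum 𝟎 𝟏 = refl
  imgWeight-sum 𝟏 𝟎 = refl
  imgWeight-sum 𝟏 𝟏 = refl

-- τ L is the multiplicity of every word of length L in f(A^(L+1)).
τ : ℕ → ℕ
τ zero = 0
τ (suc L) = τ L + τ L + 2 ^ L

column-total : ∀ x → column 𝟎 x + column 𝟏 x ≡ τ (length x)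
column-total [] = refl
column-total (d ∷ x) = begin
  column 𝟎 (d ∷ x) + column 𝟏 (d ∷ x)      ≡⟨ cong₂ _+_ (column-∷ 𝟎 d x) (column-∷ 𝟏 d x) ⟩
  (C + δ 𝟎 d * p) + (C + δ 𝟏 d * p)        ≡⟨ cong (λ T → (T + δ 𝟎 d * p) + (T + δ 𝟏 d * p)) (column-total x) ⟩
  (T + δ 𝟎 d * p) + (T + δ 𝟏 d * p)        ≡⟨ δ-pair d ⟩
  T + T + p                                ∎
  where
  C = column 𝟎 x + column 𝟏 x
  T = τ (length x)
  p = 2 ^ length x

  δ-pair : ∀ d → (T + δ 𝟎 d * p) + (T + δ 𝟏 d * p) ≡ T + T + p
  δ-pair 𝟎 = lemma T p
    where lemma : ∀ T p → (T + 1 * p) + (T + 0 * p) ≡ T + T + p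
          lemma = solve-∀
  δ-pair 𝟏 = lemma T p
    where lemma : ∀ T p → (T + 0 * p) + (T + 1 * p) ≡ T + T + p
          lemma = solve-∀

column-∷-τ : ∀ c d x → column c (d ∷ x) ≡ τ (length x) + δ c d * 2 ^ length x
column-∷-τ c d x = trans (column-∷ c d x) (cong (_+ δ c d * 2 ^ length x) (column-total x))

-- On words of length ≥ L + 1, M agrees with b·A^(L+1) + D·0A^L.
record Profile (M : Multiset) (L b D : ℕ) : Set where
  field
    m-𝟎∷ : ∀ z → length z ≡ L → m (𝟎 ∷ z) M ≡ b + D
    m-𝟏∷ : ∀ z → length z ≡ L → m (𝟏 ∷ z) M ≡ b
    m-long : ∀ w → suc L < length w → m w M ≡ 0

All-length-≤ : ∀ K M → (∀ w → K < length w → m w M ≡ 0) → All (λ y → length y ≤ K) M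
All-length-≤ K [] _ = []
All-length-≤ K (y ∷ M) noLong = |y|≤K ∷ All-length-≤ K M noLongInTail
  where
  noLongInTail : ∀ w → K < length w → m w M ≡ 0
  noLongInTail w K<|w| = m+n≡0⇒n≡0 (m w (y ∷ [])) (trans (sym (m-∷ w y M)) (noLong w K<|w|))

  |y|≤K : length y ≤ K
  |y|≤K with length y ≤? K
  ... | yes |y|≤K = |y|≤K
  ... | no |y|≰K with trans (sym (m-self y M)) (noLong y (≰⇒> |y|≰K))
  ...   | ()

m-fM-∷ : ∀ {M L b D} → Profile M (suc L) b D → ∀ c z → length z ≡ L →
  m (c ∷ z) (fM M) ≡ (b + D) * column 𝟎 (c ∷ z) + b * column 𝟏 (c ∷ z)
m-fM-∷ {M} {L} {b} {D} profile c z refl = begin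
  m x (fM M)                                 ≡⟨ m-concatMap f x M ⟩
  sum (map (λ y → m x (f y)) M)
    ≡⟨ sum-byMultiplicity K (λ y → m x (f y)) M (All.map (λ {y} → relevant {y}) (All-length-≤ K M m-long)) ⟩
  sumWords K (λ y → m y M * m x (f y))       ≡⟨ sumWords-suc (suc L) (λ y → m y M * m x (f y)) ⟩
  sumWords (suc L) (λ y → m (𝟎 ∷ y) M * m x (f (𝟎 ∷ y))) + sumWords (suc L) (λ y → m (𝟏 ∷ y) M * m x (f (𝟏 ∷ y)))
    ≡⟨ cong₂ _+_ (sumWords-cong (suc L) _ _ (λ y |y|≡1+L → cong (_* m x (f (𝟎 ∷ y))) (m-𝟎∷ y |y|≡1+L)))
                 (sumWords-cong (suc L) _ _ (λ y |y|≡1+L → cong (_* m x (f (𝟏 ∷ y))) (m-𝟏∷ y |y|≡1+L))) ⟩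
  sumWords (suc L) (λ y → (b + D) * m x (f (𝟎 ∷ y))) + sumWords (suc L) (λ y → b * m x (f (𝟏 ∷ y)))
    ≡⟨ cong₂ _+_ (sum-map-* (b + D) (λ y → m x (f (𝟎 ∷ y))) (allWords (suc L)))
                 (sum-map-* b (λ y → m x (f (𝟏 ∷ y))) (allWords (suc L))) ⟩
  (b + D) * column 𝟎 x + b * column 𝟏 x      ∎
  where
  open Profile profile
  x = c ∷ z
  K = suc (suc L)

  relevant : ∀ {y} → length y ≤ K → length y ≡ K ⊎ m x (f y) ≡ 0
  relevant {y} |y|≤K with m≤n⇒m<n∨m≡n |y|≤K
  ... | inj₂ |y|≡K = inj₁ |y|≡K
  ... | inj₁ (s≤s |y|≤|x|) = inj₂ (m-f-short y x |y|≤|x|)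

Profile-fM : ∀ {M L b D} → Profile M (suc L) b D →
  Profile (fM M) L ((b + D) * τ L + b * (τ L + 2 ^ L)) (D * 2 ^ L)
Profile-fM {M} {L} {b} {D} profile = record
  { m-𝟎∷ = λ { z refl → trans (m-fM-∷ profile 𝟎 z refl)
                                (trans (cong₂ (λ s t → (b + D) * s + b * t) (column-∷-τ 𝟎 𝟎 z) (column-∷-τ 𝟏 𝟎 z))
                                       (first-letter-𝟎 b D (τ L) (2 ^ L))) }
  ; m-𝟏∷ = λ { z refl → trans (m-fM-∷ profile 𝟏 z refl)
                                (trans (cong₂ (λ s t → (b + D) * s + b * t) (column-∷-τ 𝟎 𝟏 z) (column-∷-τ 𝟏 𝟏 z))
                                       (first-letter-𝟏 b D (τ L) (2 ^ L))) }
  ; m-long = λ w L+1<|w| → trans (m-concatMap f w M)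
               (sum-map-zero (λ y → m w (f y))
                 (All.map (λ {y} |y|≤L+2 → m-f-short y w (≤-trans |y|≤L+2 L+1<|w|)) (All-length-≤ (suc (suc L)) M m-long)))
  }
  where
  open Profile profile using (m-long)

  first-letter-𝟎 : ∀ b D T p → (b + D) * (T + 1 * p) + b * (T + 0 * p) ≡ (b + D) * T + b * (T + p) + D * p
  first-letter-𝟎 = solve-∀

  first-letter-𝟏 : ∀ b D T p → (b + D) * (T + 0 * p) + b * (T + 1 * p) ≡ (b + D) * T + b * (T + p)
  first-letter-𝟏 = solve-∀

consecutiveSum : ℕ → ℕ → ℕ
consecutiveSum zero L = 0
consecutiveSum (suc j) L = consecutiveSum j (suc L) + L

Profile-fIter : ∀ j L {M b D} → Profile M (j + L) b D →
  ∃ λ b′ → Profile (fIter j M) L b′ (D * 2 ^ consecutiveSum j L)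
Profile-fIter zero L {M} {b} {D} profile = b , subst (Profile M L b) (sym (*-identityʳ D)) profile
Profile-fIter (suc j) L {M} {b} {D} profile
  with Profile-fIter j (suc L) (subst (λ K → Profile M K b D) (sym (+-suc j L)) profile)
... | _ , profile′ = _ , subst (Profile _ L _) exponent (Profile-fM profile′)
  where
  exponent : D * 2 ^ consecutiveSum j (suc L) * 2 ^ L ≡ D * 2 ^ (consecutiveSum j (suc L) + L)
  exponent = trans (*-assoc D _ _) (cong (D *_) (sym (^-distribˡ-+-* 2 (consecutiveSum j (suc L)) L)))

consecutiveSum-double : ∀ j L → 2 * consecutiveSum j L + j ≡ j * j + 2 * j * L
consecutiveSum-double zero L = refl
consecutiveSum-double (suc j) L = begin
  2 * (consecutiveSum j (suc L) + L) + suc j       ≡⟨ expand (consecutiveSum j (suc L)) L j ⟩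
  (2 * consecutiveSum j (suc L) + j) + (2 * L + 1) ≡⟨ cong (_+ (2 * L + 1)) (consecutiveSum-double j (suc L)) ⟩
  j * j + 2 * j * suc L + (2 * L + 1)              ≡⟨ collect j L ⟩
  suc j * suc j + 2 * suc j * L                    ∎
  where
  expand : ∀ s L j → 2 * (s + L) + suc j ≡ (2 * s + j) + (2 * L + 1)
  expand = solve-∀
  collect : ∀ j L → j * j + 2 * j * suc L + (2 * L + 1) ≡ suc j * suc j + 2 * suc j * L
  collect = solve-∀

consecutiveSum-from-1 : ∀ k → consecutiveSum k 1 ≡ (suc k * k) / 2
consecutiveSum-from-1 k = sym (trans (cong (_/ 2) (sym twice)) (m*n/n≡m (consecutiveSum k 1) 2))
  where
  twice : consecutiveSum k 1 * 2 ≡ suc k * k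
  twice = trans (*-comm (consecutiveSum k 1) 2)
                (+-cancelʳ-≡ k _ _ (trans (consecutiveSum-double k 1) (rearrange k)))
    where rearrange : ∀ k → k * k + 2 * k * 1 ≡ suc k * k + k
          rearrange = solve-∀

Profile-zeroA : ∀ n → Profile (zeroA n) n 0 1
Profile-zeroA n = record
  { m-𝟎∷ = λ z |z|≡n → trans (m-∷-map 𝟎 𝟎 z (allWords n)) (cong (1 *_) (m-allWords-length n z |z|≡n))
  ; m-𝟏∷ = λ z _ → m-∷-map 𝟏 𝟎 z (allWords n)
  ; m-long = long
  }
  where
  long : ∀ w → suc n < length w → m w (zeroA n) ≡ 0
  long (c ∷ w) (s≤s n<|w|) = begin
    m (c ∷ w) (zeroA n)       ≡⟨ m-∷-map c 𝟎 w (allWords n) ⟩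
    δ c 𝟎 * m w (allWords n)  ≡⟨ cong (δ c 𝟎 *_) (m-allWords-≢ n w (λ |w|≡n → <-irrefl (sym |w|≡n) n<|w|)) ⟩
    δ c 𝟎 * 0                 ≡⟨ *-zeroʳ (δ c 𝟎) ⟩
    0                         ∎

factorizations-𝟏ⁿ : ∀ n → factorizations (replicate n 𝟏) ≡ replicate n letter ∷ []
factorizations-𝟏ⁿ zero = refl
factorizations-𝟏ⁿ (suc zero) = refl
factorizations-𝟏ⁿ (suc (suc n)) rewrite factorizations-𝟏ⁿ (suc n) = refl

isφFact-letters : ∀ n → isφFact (replicate n letter) ≡ false
isφFact-letters zero = refl
isφFact-letters (suc n) = isφFact-letters n

lang-letters : ∀ n → lang (replicate n letter) ≡ allWords n
lang-letters zero = refl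
lang-letters (suc n) rewrite lang-letters n = refl

-- The only φ-factorization of 01ⁿ⁺¹ is φ(0)·1ⁿ.
f-𝟎𝟏ⁿ⁺¹ : ∀ n → f (𝟎 ∷ 𝟏 ∷ replicate n 𝟏) ≡ zeroA n
f-𝟎𝟏ⁿ⁺¹ n rewrite factorizations-𝟏ⁿ (suc n) | factorizations-𝟏ⁿ n | isφFact-letters n | lang-letters n =
  ++-identityʳ (zeroA n)

fIter-suc : ∀ k M → fIter (suc k) M ≡ fIter k (fM M)
fIter-suc zero M = refl
fIter-suc (suc k) M = cong fM (fIter-suc k M)

fPow-𝟎𝟏ⁿ⁺¹ : ∀ k → fPow (suc k) (𝟎 ∷ replicate (suc k + 1) 𝟏) ≡ fIter k (zeroA (suc k))
fPow-𝟎𝟏ⁿ⁺¹ k = begin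
  fIter (suc k) ((𝟎 ∷ 𝟏 ∷ replicate (k + 1) 𝟏) ∷ [])  ≡⟨ fIter-suc k _ ⟩
  fIter k (f (𝟎 ∷ 𝟏 ∷ replicate (k + 1) 𝟏) ++ [])      ≡⟨ cong (fIter k) (++-identityʳ _) ⟩
  fIter k (f (𝟎 ∷ 𝟏 ∷ replicate (k + 1) 𝟏))            ≡⟨ cong (λ n → fIter k (f (𝟎 ∷ 𝟏 ∷ replicate n 𝟏))) (+-comm k 1) ⟩
  fIter k (f (𝟎 ∷ 𝟏 ∷ replicate (suc k) 𝟏))            ≡⟨ cong (fIter k) (f-𝟎𝟏ⁿ⁺¹ (suc k)) ⟩
  fIter k (zeroA (suc k))                                ∎

-- Imported only here: the prefix +_ would make the sections (n +_) above ambiguous.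
open import Data.Integer using (+_; _-_; _⊖_)
open import Data.Integer.Properties using ([+m]-[+n]≡m⊖n; ⊖-≥)

Profile-difference : ∀ {M L b D} → Profile M L b D → ∀ {z z′} → length z ≡ L → length z′ ≡ L →
  (+ m (𝟎 ∷ z) M) - (+ m (𝟏 ∷ z′) M) ≡ + D
Profile-difference {M} {b = b} {D} profile {z} {z′} |z|≡L |z′|≡L = begin
  (+ m (𝟎 ∷ z) M) - (+ m (𝟏 ∷ z′) M) ≡⟨ cong₂ (λ s t → (+ s) - (+ t)) (m-𝟎∷ z |z|≡L) (m-𝟏∷ z′ |z′|≡L) ⟩
  (+ (b + D)) - (+ b)                  ≡⟨ [+m]-[+n]≡m⊖n (b + D) b ⟩
  (b + D) ⊖ b                          ≡⟨ ⊖-≥ (m≤m+n b D) ⟩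
  + (b + D ∸ b)                        ≡⟨ cong +_ (m+n∸m≡n b D) ⟩
  + D                                  ∎
  where open Profile profile

proposition4p3 : (n : ℕ) → n ≥ 1 →
    let M = fPow n (𝟎 ∷ replicate (n + 1) 𝟏) in
    (M ↭ fIter (n ∸ 1) (zeroA n))
    × ((+ m (𝟎 ∷ 𝟏 ∷ []) M) - (+ m (𝟏 ∷ 𝟎 ∷ []) M) ≡ + (2 ^ ((n * (n ∸ 1)) / 2)))
    × ((+ m (𝟎 ∷ 𝟎 ∷ []) M) - (+ m (𝟏 ∷ 𝟏 ∷ []) M) ≡ + (2 ^ ((n * (n ∸ 1)) / 2)))
proposition4p3 (suc k) _ rewrite fPow-𝟎𝟏ⁿ⁺¹ k = ↭-refl , difference refl refl , difference refl refl
  where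
  profile : ∃ λ b → Profile (fIter k (zeroA (suc k))) 1 b (1 * 2 ^ consecutiveSum k 1)
  profile = Profile-fIter k 1 (subst (λ L → Profile (zeroA (suc k)) L 0 1) (+-comm 1 k) (Profile-zeroA (suc k)))

  difference : ∀ {z z′} → length z ≡ 1 → length z′ ≡ 1 →
    (+ m (𝟎 ∷ z) (fIter k (zeroA (suc k)))) - (+ m (𝟏 ∷ z′) (fIter k (zeroA (suc k)))) ≡ + (2 ^ ((suc k * k) / 2))
  difference |z|≡1 |z′|≡1 =
    trans (Profile-difference (proj₂ profile) |z|≡1 |z′|≡1)
          (cong +_ (trans (*-identityˡ _) (cong (2 ^_) (consecutiveSum-from-1 k))))
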